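{- Let $G$ be a simple graph on the vertex set $[n]$, and let $\mathcal{F}$ be the set of orderings $(c_1,\dots,c_n)$ of $[n]$ with the following property: for every $i$, if $j\le i$ is minimal such that none of $c_j,\dots,c_{i-1}$ is adjacent to $c_i$ in $G$, then either $j=i$ or $\min\{c_j,\dots,c_{i-1}\}>c_i$. Then there is a bijection between $\mathcal{F}$ and the set of acyclic orientations of $G$.
   Context: In the paper, $G=\Gamma\smallsetminus\{P,Q\}$ for a graph $\Gamma$ with two dominating vertices $P,Q$, and $\mathcal{F}$ is the set of fixed points of the left-right involution on $\Gamma$-millipedes (ordered set partitions of $[n]$ into independent sets of $G$), which are exactly the millipedes with all blocks singletons satisfying the stated condition. -}

module Defs where

open import Level using (0ℓ)
open import Data.Nat using (ℕ)
open import Data.Fin using (Fin; _≤_; _<_)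
open import Data.Bool using (Bool; true; false; not)
open import Data.Product using (Σ; _×_; proj₁; proj₂)
open import Data.Sum using (_⊎_)
open import Relation.Nullary using (¬_)
open import Relation.Binary using (Setoid; Decidable)
open import Relation.Binary.PropositionalEquality using (_≡_; refl; sym; trans)
open import Relation.Binary.Construct.Closure.Transitive using (TransClosure)
open import Function.Definitions using (Injective)

record SimpleGraph (n : ℕ) : Set₁ where
  field
    Adj    : Fin n → Fin n → Set
    adj?   : Decidable Adj
    adj-sym : ∀ {u v} → Adj u v → Adj v u
    adj-irrefl : ∀ {u} → ¬ Adj u u
open SimpleGraph public

-- An ordering (c_1,…,c_n) of [n]: position i ↦ c i, injective (hence bijective).
Ordering : ℕ → Set
Ordering n = Σ (Fin n → Fin n) (Injective _≡_ _≡_)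

NoneAdj : ∀ {n} (G : SimpleGraph n) → (Fin n → Fin n) → Fin n → Fin n → Set
NoneAdj G c j i = ∀ k → j ≤ k → k < i → ¬ Adj G (c k) (c i)

InF : ∀ {n} (G : SimpleGraph n) → Ordering n → Set
InF G o =
  let c = proj₁ o in
  ∀ i j → j ≤ i → NoneAdj G c j i →
  (∀ j′ → j′ < j → ¬ NoneAdj G c j′ i) →
  (j ≡ i) ⊎ (∀ k → j ≤ k → k < i → c i < c k)

F : ∀ {n} → SimpleGraph n → Set
F G = Σ (Ordering _) (InF G)

-- Orientations of G: O u v = true means the edge {u,v} is oriented u → v.
IsOrientation : ∀ {n} (G : SimpleGraph n) → (Fin n → Fin n → Bool) → Set
IsOrientation G O =
  (∀ u v → O u v ≡ true → Adj G u v) ×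
  (∀ u v → Adj G u v → O u v ≡ not (O v u))

Acyclic : ∀ {n} → (Fin n → Fin n → Bool) → Set
Acyclic O = ∀ u → ¬ TransClosure (λ a b → O a b ≡ true) u u

AcyclicOrientation : ∀ {n} → SimpleGraph n → Set
AcyclicOrientation G = Σ _ (λ O → IsOrientation G O × Acyclic O)

FSetoid : ∀ {n} → SimpleGraph n → Setoid 0ℓ 0ℓ
FSetoid G = record
  { Carrier = F G
  ; _≈_ = λ x y → ∀ i → proj₁ (proj₁ x) i ≡ proj₁ (proj₁ y) i
  ; isEquivalence = record
    { refl = λ i → refl ; sym = λ p i → sym (p i) ; trans = λ p q i → trans (p i) (q i) } }

AOSetoid : ∀ {n} → SimpleGraph n → Setoid 0ℓ 0ℓ
AOSetoid G = record
  { Carrier = AcyclicOrientation G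
  ; _≈_ = λ x y → ∀ u v → proj₁ x u v ≡ proj₁ y u v
  ; isEquivalence = record
    { refl = λ u v → refl ; sym = λ p u v → sym (p u v)
    ; trans = λ p q u v → trans (p u v) (q u v) } }

-- An ordering c induces the acyclic orientation "u → v iff u, v are adjacent and u
-- comes first in c". Restricted to 𝓕 this map is injective: if two orderings in 𝓕
-- induce the same orientation and first differ at position k, then the vertex d k
-- sits at some later position i of c, and nothing in c_k,…,c_{i-1} is adjacent to
-- it, so the defining property of 𝓕 forces d k < c k; by symmetry also c k < d k.
-- Conversely, a given acyclic orientation is induced by the greedy linear extension
-- that always picks the largest vertex all of whose in-neighbours are already
-- placed (one exists, as the orientation is acyclic): a vertex not adjacent to
-- anything placed between steps j and i was already available at each of those
-- steps, so it is smaller than every vertex picked there, and the ordering lies in 𝓕.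
module Submission where

open import Defs
open import Data.Nat using (ℕ)
open import Function.Bundles using (Bijection)

open import Level using (Level)
import Data.Nat.Base as ℕ
import Data.Nat.Properties as ℕ
open import Data.Nat.Base using (zero; suc; z≤n; s≤s)
open import Data.Fin.Base using (Fin; zero; suc; toℕ; fromℕ<; punchOut; _≤_; _<_)
open import Data.Fin.Properties
  using ( _≟_; _≤?_; _<?_; any?; all?; ¬∀⟶∃¬; pigeonhole; injective⇒≤
        ; toℕ-injective; toℕ<n; toℕ-fromℕ<; fromℕ<-injective; punchOut-injective
        ; ≤-antisym; <-cmp; <-asym; <⇒≢; ≤∧≢⇒< )
open import Data.Bool.Base using (Bool; true; false; not; _∧_)
import Data.Bool.Properties as Bool
open import Data.Empty using (⊥)
open import Data.Product using (Σ; ∃; _×_; _,_; proj₁; proj₂)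
open import Data.Sum using (_⊎_; inj₁; inj₂; [_,_]′)
open import Function.Base using (_∘_)
open import Function.Definitions using (Injective)
open import Relation.Binary.Core using (Rel)
open import Relation.Binary.Definitions using (DecidableEquality; tri<; tri≈; tri>)
open import Relation.Binary.PropositionalEquality
  using (_≡_; _≢_; refl; sym; trans; cong; cong₂; subst; subst₂; module ≡-Reasoning)
open import Relation.Binary.Construct.Closure.Transitive using (TransClosure; [_]; _∷_)
open import Relation.Nullary using (¬_; Dec; does; yes; no; contradiction)
open import Relation.Nullary.Decidable
  using (dec-true; dec-false; decidable-stable; ¬?; _×-dec_; _⊎-dec_; _→-dec_)
open import Relation.Unary using (Pred; Decidable)

private
  variable
    ℓ r : Level
    n : ℕ

injective⇒surjective : {f : Fin n → Fin n} → Injective _≡_ _≡_ f → ∀ u → ∃ λ i → f i ≡ u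
injective⇒surjective {zero}      _           ()
injective⇒surjective {suc n} {f} f-injective u with any? (λ i → f i ≟ u)
... | yes hit = hit
... | no miss = contradiction (injective⇒≤ punchOut-injective′) ℕ.1+n≰n
  where
  u≢f : ∀ i → u ≢ f i
  u≢f i u≡fi = miss (i , sym u≡fi)

  punchOut-injective′ : Injective _≡_ _≡_ (λ i → punchOut (u≢f i))
  punchOut-injective′ eq = f-injective (punchOut-injective (u≢f _) (u≢f _) eq)

least : {P : Pred (Fin n) ℓ} → Decidable P → ∀ {i} → P i →
        ∃ λ j → j ≤ i × P j × (∀ k → k < j → ¬ P k)
least {suc n} P? {zero}  P0 = zero , z≤n , P0 , λ _ ()
least {suc n} P? {suc i} Pi with P? zero
... | yes P0 = zero , z≤n , P0 , λ _ ()
... | no ¬P0 with j , j≤i , Pj , below ← least (P? ∘ suc) Pi =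
  suc j , s≤s j≤i , Pj , λ { zero _ → ¬P0 ; (suc k) k<j → below k (ℕ.s≤s⁻¹ k<j) }

greatest : {P : Pred (Fin n) ℓ} → Decidable P → ∀ {i} → P i →
           ∃ λ j → P j × (∀ k → P k → k ≤ j)
greatest {suc n} {P = P} P? {i} Pi with any? (P? ∘ suc)
... | yes (_ , Psi) with j , Pj , above ← greatest (P? ∘ suc) Psi =
  suc j , Pj , λ { zero _ → z≤n ; (suc k) Pk → s≤s (above k Pk) }
... | no none = zero , P-zero i Pi , λ { zero _ → z≤n ; (suc k) Pk → contradiction (k , Pk) none }
  where
  P-zero : ∀ i → P i → P zero
  P-zero zero    P0  = P0
  P-zero (suc i) Psi = contradiction (i , Psi) none

firstDifference : {A : Set} → DecidableEquality A → {f g : Fin n → A} → ∀ {i} → f i ≢ g i →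
                  ∃ λ k → f k ≢ g k × (∀ m → m < k → f m ≡ g m)
firstDifference _≟ᴬ_ {f} {g} fi≢gi
  with k , _ , fk≢gk , below ← least (λ x → ¬? (f x ≟ᴬ g x)) fi≢gi =
  k , fk≢gk , λ m m<k → decidable-stable (f m ≟ᴬ g m) (below m m<k)

module _ {R : Rel (Fin n) r} (R-acyclic : ∀ u → ¬ TransClosure R u u) where

  no-descending-walk : (w : ℕ → Fin n) → ¬ (∀ i → R (w (suc i)) (w i))
  no-descending-walk w step
    with i , j , i<j , wi≡wj ← pigeonhole (ℕ.n<1+n n) (w ∘ toℕ) =
    R-acyclic _ (subst (TransClosure R (w (toℕ j))) wi≡wj (walk i<j))
    where
    walk : ∀ {i j} → i ℕ.< j → TransClosure R (w j) (w i)
    walk {i} {suc j} i<1+j with ℕ.m<1+n⇒m<n∨m≡n i<1+j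
    ... | inj₁ i<j  = step j ∷ walk i<j
    ... | inj₂ refl = [ step j ]

  acyclic⇒source : (∀ u v → Dec (R u v)) → {P : Pred (Fin n) ℓ} → Decidable P →
                   ∀ {w} → P w → ∃ λ v → P v × (∀ u → R u v → ¬ P u)
  acyclic⇒source R? {P} P? {w} Pw
    with any? (λ v → P? v ×-dec all? (λ u → R? u v →-dec ¬? (P? u)))
  ... | yes source = source
  ... | no ¬source = contradiction step (no-descending-walk (proj₁ ∘ walk))
    where
    predecessor : ∀ {v} → P v → ∃ λ u → R u v × P u
    predecessor {v} Pv
      with u , ¬[Ruv→¬Pu] ← ¬∀⟶∃¬ n _ (λ u → R? u v →-dec ¬? (P? u))
                                      (¬source ∘ (v ,_) ∘ (Pv ,_)) =
      u , decidable-stable (R? u v) (λ ¬Ruv → ¬[Ruv→¬Pu] (λ Ruv → contradiction Ruv ¬Ruv))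
        , decidable-stable (P? u) (λ ¬Pu → ¬[Ruv→¬Pu] (λ _ → ¬Pu))

    walk : ℕ → Σ (Fin n) P
    walk zero    = w , Pw
    walk (suc i) = let (u , _ , Pu) = predecessor (proj₂ (walk i)) in u , Pu

    step : ∀ i → R (proj₁ (walk (suc i))) (proj₁ (walk i))
    step i = proj₁ (proj₂ (predecessor (proj₂ (walk i))))

dec-true⁻¹ : {A : Set ℓ} (a? : Dec A) → does a? ≡ true → A
dec-true⁻¹ (yes a) _  = a
dec-true⁻¹ (no _)  ()

does-<?-complement : {i j : Fin n} → i ≢ j → does (i <? j) ≡ not (does (j <? i))
does-<?-complement {i = i} {j} i≢j with <-cmp i j
... | tri< i<j _ _ = trans (dec-true (i <? j) i<j) (cong not (sym (dec-false (j <? i) (<-asym i<j))))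
... | tri≈ _ i≡j _ = contradiction i≡j i≢j
... | tri> _ _ j<i = trans (dec-false (i <? j) (<-asym j<i)) (cong not (sym (dec-true (j <? i) j<i)))

module _ (o : Ordering n) where

  position : Fin n → Fin n
  position u = proj₁ (injective⇒surjective (proj₂ o) u)

  ordering-position : ∀ u → proj₁ o (position u) ≡ u
  ordering-position u = proj₂ (injective⇒surjective (proj₂ o) u)

  position-ordering : ∀ i → position (proj₁ o i) ≡ i
  position-ordering i = proj₂ o (ordering-position (proj₁ o i))

  position-injective : Injective _≡_ _≡_ position
  position-injective {u} {v} eq =
    trans (sym (ordering-position u)) (trans (cong (proj₁ o) eq) (ordering-position v))

position-cong : (o o′ : Ordering n) → (∀ i → proj₁ o i ≡ proj₁ o′ i) →
                ∀ u → position o u ≡ position o′ u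
position-cong o o′ o≗o′ u = proj₂ o′ (begin
  proj₁ o′ (position o u)   ≡⟨ sym (o≗o′ (position o u)) ⟩
  proj₁ o (position o u)    ≡⟨ ordering-position o u ⟩
  u                         ≡⟨ sym (ordering-position o′ u) ⟩
  proj₁ o′ (position o′ u)  ∎)
  where open ≡-Reasoning

module GreedyLinearExtension {n} (O : Fin n → Fin n → Bool) (O-acyclic : Acyclic O) where

  Available : Pred (Fin n) ℓ → Pred (Fin n) ℓ
  Available T v = ¬ T v × (∀ u → O u v ≡ true → T u)

  Next : Pred (Fin n) ℓ → Pred (Fin n) ℓ
  Next T v = Available T v × (∀ w → Available T w → w ≤ v)

  Placed : ℕ → Pred (Fin n) _
  Placed zero    _ = ⊥
  Placed (suc k) u = Placed k u ⊎ Next (Placed k) u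

  Chosen : ℕ → Pred (Fin n) _
  Chosen k = Next (Placed k)

  available? : {T : Pred (Fin n) ℓ} → Decidable T → Decidable (Available T)
  available? T? v = ¬? (T? v) ×-dec all? (λ u → (O u v Bool.≟ true) →-dec T? u)

  next? : {T : Pred (Fin n) ℓ} → Decidable T → Decidable (Next T)
  next? T? v = available? T? v ×-dec all? (λ w → available? T? w →-dec w ≤? v)

  placed? : ∀ k → Decidable (Placed k)
  placed? zero    _ = no λ ()
  placed? (suc k) u = placed? k u ⊎-dec next? (placed? k) u

  next-unique : {T : Pred (Fin n) ℓ} → ∀ {u v} → Next T u → Next T v → u ≡ v
  next-unique (u-available , u-max) (v-available , v-max) =
    ≤-antisym (v-max _ u-available) (u-max _ v-available)

  placed⇒chosen : ∀ {k u} → Placed k u → ∃ λ m → m ℕ.< k × Chosen m u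
  placed⇒chosen {suc k} (inj₁ t)  =
    let (m , m<k , ch) = placed⇒chosen t in m , ℕ.m<n⇒m<1+n m<k , ch
  placed⇒chosen {suc k} (inj₂ ch) = k , ℕ.n<1+n k , ch

  chosen⇒placed : ∀ {m k u} → Chosen m u → m ℕ.< k → Placed k u
  chosen⇒placed {m} {suc k} ch m<1+k with ℕ.m<1+n⇒m<n∨m≡n m<1+k
  ... | inj₁ m<k  = inj₁ (chosen⇒placed ch m<k)
  ... | inj₂ refl = inj₂ ch

  chosen-once : ∀ {m m′ u} → Chosen m u → Chosen m′ u → m ≡ m′
  chosen-once {m} {m′} ch ch′ with ℕ.<-cmp m m′
  ... | tri< m<m′ _ _ = contradiction (chosen⇒placed ch m<m′) (proj₁ (proj₁ ch′))
  ... | tri≈ _ m≡m′ _ = m≡m′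
  ... | tri> _ _ m′<m = contradiction (chosen⇒placed ch′ m′<m) (proj₁ (proj₁ ch))

  -- Otherwise "the step at which v was placed" would inject Fin n into Fin k.
  unplaced-exists : ∀ {k} → k ℕ.< n → ∃ λ v → ¬ Placed k v
  unplaced-exists {k} k<n = ¬∀⟶∃¬ n (Placed k) (placed? k) λ all-placed →
    let step : ∀ v → ∃ λ m → m ℕ.< k × Chosen m v
        step v = placed⇒chosen (all-placed v)
        step-injective : Injective _≡_ _≡_ (λ v → fromℕ< (proj₁ (proj₂ (step v))))
        step-injective {v} {w} eq =
          next-unique (proj₂ (proj₂ (step v)))
            (subst (λ m → Chosen m w) (sym (fromℕ<-injective _ _ _ _ eq)) (proj₂ (proj₂ (step w))))
    in ℕ.<⇒≱ k<n (injective⇒≤ step-injective)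

  chosen-exists : ∀ {k} → k ℕ.< n → ∃ (Chosen k)
  chosen-exists {k} k<n =
    let (v , v-unplaced) = unplaced-exists k<n
        (s , s-unplaced , predecessors-placed) =
          acyclic⇒source O-acyclic (λ u v → O u v Bool.≟ true) (¬? ∘ placed? k) v-unplaced
    in greatest (available? (placed? k))
         (s-unplaced , λ u Ous → decidable-stable (placed? k u) (predecessors-placed u Ous))

  -- Kept opaque so that unification never unfolds c into the search behind chosen-exists.
  opaque
    c : Fin n → Fin n
    c i = proj₁ (chosen-exists (toℕ<n i))

    c-chosen : ∀ i → Chosen (toℕ i) (c i)
    c-chosen i = proj₂ (chosen-exists (toℕ<n i))

  c-injective : Injective _≡_ _≡_ c
  c-injective {i} {j} ci≡cj =
    toℕ-injective (chosen-once (c-chosen i) (subst (Chosen (toℕ j)) (sym ci≡cj) (c-chosen j)))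

  ordering : Ordering n
  ordering = c , c-injective

  c-placed : ∀ {i m : Fin n} → i < m → Placed (toℕ m) (c i)
  c-placed {i} = chosen⇒placed (c-chosen i)

  placed⇒c : ∀ {m : Fin n} {u} → Placed (toℕ m) u → ∃ λ i → i < m × c i ≡ u
  placed⇒c {m} t =
    let (k , k<m , u-chosen) = placed⇒chosen t
        k<n = ℕ.<-trans k<m (toℕ<n m)
        i = fromℕ< k<n
        ci-chosen : Chosen k (c i)
        ci-chosen = subst (λ k → Chosen k (c i)) (toℕ-fromℕ< k<n) (c-chosen i)
    in i , subst (ℕ._< toℕ m) (sym (toℕ-fromℕ< k<n)) k<m , next-unique ci-chosen u-chosen

  c-placed⇒< : ∀ {i m : Fin n} → Placed (toℕ m) (c i) → i < m
  c-placed⇒< t with j , j<m , cj≡ci ← placed⇒c t = subst (_< _) (c-injective cj≡ci) j<m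

  c-increasing : ∀ {i j} → O (c i) (c j) ≡ true → i < j
  c-increasing {i} {j} O-cicj = c-placed⇒< (proj₂ (proj₁ (c-chosen j)) (c i) O-cicj)

  c-inF : (G : SimpleGraph n) → (∀ u v → O u v ≡ true → Adj G u v) → InF G ordering
  c-inF G O⊆Adj i j _ none-adjacent _ = inj₂ c-larger
    where
    c-larger : ∀ m → j ≤ m → m < i → c i < c m
    c-larger m j≤m m<i =
      ≤∧≢⇒< (proj₂ (c-chosen m) (c i) ci-available) (<⇒≢ m<i ∘ c-injective ∘ sym)
      where
      ci-available : Available (Placed (toℕ m)) (c i)
      ci-available = (λ t → <-asym m<i (c-placed⇒< t)) , predecessors-placed
        where
        predecessors-placed : ∀ u → O u (c i) ≡ true → Placed (toℕ m) u
        predecessors-placed u O-u-ci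
          with q , q<i , cq≡u ← placed⇒c (proj₂ (proj₁ (c-chosen i)) u O-u-ci) =
          subst (Placed (toℕ m)) cq≡u (c-placed (ℕ.<-≤-trans q<j j≤m))
          where
          q<j : q < j
          q<j = decidable-stable (q <? j) λ q≮j →
            none-adjacent q (ℕ.≮⇒≥ q≮j) q<i
              (O⊆Adj (c q) (c i) (subst (λ u → O u (c i) ≡ true) (sym cq≡u) O-u-ci))

module InducedOrientation {n} (G : SimpleGraph n) where

  orient : Ordering n → Fin n → Fin n → Bool
  orient o u v = does (adj? G u v) ∧ does (position o u <? position o v)

  orient-true⇒ : ∀ o {u v} → orient o u v ≡ true → Adj G u v × position o u < position o v
  orient-true⇒ o {u} {v} uv with adj? G u v
  ... | yes adj = adj , dec-true⁻¹ (position o u <? position o v) uv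
  ... | no _    = contradiction uv λ ()

  orient-true⇐ : ∀ o {u v} → Adj G u v → position o u < position o v → orient o u v ≡ true
  orient-true⇐ o {u} {v} adj before =
    cong₂ _∧_ (dec-true (adj? G u v) adj) (dec-true (_ <? _) before)

  orient-adjacent : ∀ o {u v} → Adj G u v → orient o u v ≡ does (position o u <? position o v)
  orient-adjacent o {u} {v} adj = cong (_∧ _) (dec-true (adj? G u v) adj)

  orient-isOrientation : ∀ o → IsOrientation G (orient o)
  orient-isOrientation o = (λ u v → proj₁ ∘ orient-true⇒ o) , antisymmetric
    where
    open ≡-Reasoning
    antisymmetric : ∀ u v → Adj G u v → orient o u v ≡ not (orient o v u)
    antisymmetric u v adj = begin
      orient o u v                                ≡⟨ orient-adjacent o adj ⟩
      does (position o u <? position o v)         ≡⟨ does-<?-complement distinct ⟩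
      not (does (position o v <? position o u))   ≡⟨ cong not (sym (orient-adjacent o (adj-sym G adj))) ⟩
      not (orient o v u)                          ∎
      where
      distinct : position o u ≢ position o v
      distinct eq = adj-irrefl G (subst (Adj G u) (sym (position-injective o eq)) adj)

  orient-increasing : ∀ o {u v} → TransClosure (λ a b → orient o a b ≡ true) u v →
                      position o u < position o v
  orient-increasing o [ uv ]     = proj₂ (orient-true⇒ o uv)
  orient-increasing o (uw ∷ wv) = ℕ.<-trans (proj₂ (orient-true⇒ o uw)) (orient-increasing o wv)

  orient-acyclic : ∀ o → Acyclic (orient o)
  orient-acyclic o u cycle = ℕ.<-irrefl refl (orient-increasing o cycle)

  orient-cong : ∀ o o′ → (∀ i → proj₁ o i ≡ proj₁ o′ i) → ∀ u v → orient o u v ≡ orient o′ u v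
  orient-cong o o′ o≗o′ u v =
    cong₂ (λ i j → does (adj? G u v) ∧ does (i <? j))
          (position-cong o o′ o≗o′ u) (position-cong o o′ o≗o′ v)

  orientation-⊆⇒≡ : ∀ {O O′} → IsOrientation G O → IsOrientation G O′ →
                    (∀ u v → O u v ≡ true → O′ u v ≡ true) → ∀ u v → O u v ≡ O′ u v
  orientation-⊆⇒≡ {O} {O′} (_ , O-flip) (O′⊆Adj , O′-flip) O⊆O′ u v with O u v in Ouv
  ... | true  = sym (O⊆O′ u v Ouv)
  ... | false with adj? G u v
  ...   | no ¬uv = sym (Bool.¬-not (¬uv ∘ O′⊆Adj u v))
  ...   | yes uv = sym (begin
    O′ u v        ≡⟨ O′-flip u v uv ⟩
    not (O′ v u)  ≡⟨ cong not (O⊆O′ v u (trans (O-flip v u (adj-sym G uv)) (cong not Ouv))) ⟩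
    false         ∎)
    where open ≡-Reasoning

  orient-ordered : ∀ o {i j} → Adj G (proj₁ o i) (proj₁ o j) → i < j →
                   orient o (proj₁ o i) (proj₁ o j) ≡ true
  orient-ordered o {i} {j} adj i<j =
    orient-true⇐ o adj (subst₂ _<_ (sym (position-ordering o i)) (sym (position-ordering o j)) i<j)

  noneAdj? : ∀ c j i → Dec (NoneAdj G c j i)
  noneAdj? c j i = all? λ k → j ≤? k →-dec k <? i →-dec ¬? (adj? G (c k) (c i))

  firstDifference-< : (x y : F G) → (∀ u v → orient (proj₁ x) u v ≡ orient (proj₁ y) u v) →
                      let c = proj₁ (proj₁ x); d = proj₁ (proj₁ y) in
                      ∀ {k} → (∀ m → m < k → c m ≡ d m) → c k ≢ d k → d k < c k
  firstDifference-< (oc@(c , c-injective) , c∈F) (od@(d , d-injective) , _) same {k} agree ck≢dk =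
    let (j , j≤k , none-j , j-minimal) = least (λ j → noneAdj? c j i) none-k
    in [ (λ j≡i → contradiction j≡i (<⇒≢ (ℕ.≤-<-trans j≤k k<i)))
       , (λ larger → subst (_< c k) ci≡dk (larger k j≤k k<i))
       ]′ (c∈F i j (ℕ.≤-trans j≤k (ℕ.<⇒≤ k<i)) none-j j-minimal)
    where
    i : Fin n
    i = position oc (d k)

    ci≡dk : c i ≡ d k
    ci≡dk = ordering-position oc (d k)

    k<i : k < i
    k<i with <-cmp i k
    ... | tri< i<k _ _ = contradiction (d-injective (trans (sym (agree i i<k)) ci≡dk)) (<⇒≢ i<k)
    ... | tri≈ _ i≡k _ = contradiction (trans (cong c (sym i≡k)) ci≡dk) ck≢dk
    ... | tri> _ _ k<i = k<i

    -- A neighbour of d k placed after it in c was placed before it in d, where d agrees with c.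
    none-k : NoneAdj G c k i
    none-k m k≤m m<i adj = ℕ.<⇒≱ (subst (_< k) p≡m p<k) k≤m
      where
      p : Fin n
      p = position od (c m)

      p<k : p < k
      p<k = subst (p <_) (trans (cong (position od) ci≡dk) (position-ordering od k))
              (proj₂ (orient-true⇒ od (trans (sym (same (c m) (c i))) (orient-ordered oc adj m<i))))

      p≡m : p ≡ m
      p≡m = c-injective (trans (agree p p<k) (ordering-position od (c m)))

  orient-injective : (x y : F G) → (∀ u v → orient (proj₁ x) u v ≡ orient (proj₁ y) u v) →
                     ∀ i → proj₁ (proj₁ x) i ≡ proj₁ (proj₁ y) i
  orient-injective x y same i = decidable-stable (c i ≟ d i) λ ci≢di →
    let (k , ck≢dk , agree) = firstDifference _≟_ ci≢di
    in <-asym (firstDifference-< x y same agree ck≢dk)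
              (firstDifference-< y x (λ u v → sym (same u v)) (λ m m<k → sym (agree m m<k))
                                 (ck≢dk ∘ sym))
    where
    c d : Fin n → Fin n
    c = proj₁ (proj₁ x)
    d = proj₁ (proj₁ y)

  orient-surjective : (y : AcyclicOrientation G) → ∃ λ (x : F G) → ∀ {z : F G} →
                      (∀ i → proj₁ (proj₁ z) i ≡ proj₁ (proj₁ x) i) →
                      ∀ u v → orient (proj₁ z) u v ≡ proj₁ y u v
  orient-surjective (O , O-orientation@(O⊆Adj , _) , O-acyclic) =
    (ordering , c-inF G O⊆Adj) ,
    λ {z} z≈x u v → trans (orient-cong (proj₁ z) ordering z≈x u v) (sym (O≡orient u v))
    where
    open GreedyLinearExtension O O-acyclic

    O⊆orient : ∀ u v → O u v ≡ true → orient ordering u v ≡ true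
    O⊆orient u v Ouv = orient-true⇐ ordering (O⊆Adj u v Ouv) (c-increasing
      (subst₂ (λ a b → O a b ≡ true)
              (sym (ordering-position ordering u)) (sym (ordering-position ordering v)) Ouv))

    O≡orient : ∀ u v → O u v ≡ orient ordering u v
    O≡orient = orientation-⊆⇒≡ O-orientation (orient-isOrientation ordering) O⊆orient

lemma3p16 : (n : ℕ) (G : SimpleGraph n) → Bijection (FSetoid G) (AOSetoid G)
lemma3p16 n G = record
  { to        = λ x → orient (proj₁ x) , orient-isOrientation (proj₁ x) , orient-acyclic (proj₁ x)
  ; cong      = λ {x} {y} → orient-cong (proj₁ x) (proj₁ y)
  ; bijective = (λ {x} {y} → orient-injective x y) , orient-surjective
  }
  where open InducedOrientation G
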